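{- There exists a connected, locally finite, quasi-transitive graph $G$ with infinitely many ends, chromatic number $\chi(G)=3$ and maximum degree $\Delta(G)=4$, such that $G$ has a periodic proper vertex-coloring with $4=\chi(G)+1$ colors but no periodic proper vertex-coloring with $3=\chi(G)$ colors.
   Context: A graph is quasi-transitive if its vertex set has finitely many orbits under its automorphism group. A ray is a one-way infinite path; two rays are equivalent if there are infinitely many disjoint paths between them, and an end is an equivalence class of rays. A vertex-coloring is proper if adjacent vertices get distinct colors, and periodic if the subgroup of automorphisms mapping each vertex to a vertex of the same color has finitely many orbits on the vertex set. -}

module Defs where

open import Data.Nat using (ℕ; zero; suc; _<_)
open import Data.Unit using (⊤)
open import Data.Fin using (Fin; zero; suc; inject₁; fromℕ)
open import Data.List using (List)
open import Data.List.Membership.Propositional using (_∈_)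
open import Data.Product using (Σ; ∃; ∃-syntax; _×_; _,_)
open import Relation.Binary.PropositionalEquality using (_≡_; _≢_)
open import Relation.Nullary using (¬_)
open import Function.Bundles using (_↔_; Inverse)
open import Function.Definitions using (Injective)

record Graph : Set₁ where
  field
    V      : Set
    _~_    : V → V → Set
    ~-sym  : ∀ {u v} → u ~ v → v ~ u
    ~-irr  : ∀ {v} → ¬ (v ~ v)

module _ (G : Graph) where
  open Graph G

  record Path : Set where
    field
      len : ℕ
      vtx : Fin (suc len) → V
      adj : ∀ (i : Fin len) → vtx (inject₁ i) ~ vtx (suc i)
      inj : Injective _≡_ _≡_ vtx

  start : Path → V
  start P = Path.vtx P zero

  end : Path → V
  end P = Path.vtx P (fromℕ (Path.len P))

  record Ray : Set where
    field
      seq : ℕ → V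
      adj : ∀ n → seq n ~ seq (suc n)
      inj : Injective _≡_ _≡_ seq

  Disjoint : Path → Path → Set
  Disjoint P Q = ∀ a b → Path.vtx P a ≢ Path.vtx Q b

  EquivRays : Ray → Ray → Set
  EquivRays R S =
    Σ (ℕ → Path) λ P →
      (∀ i → (∃[ j ] start (P i) ≡ Ray.seq R j) × (∃[ k ] end (P i) ≡ Ray.seq S k))
      × (∀ i j → i ≢ j → Disjoint (P i) (P j))

  -- Infinitely many ends: for every n there are n pairwise inequivalent rays
  -- (i.e. the set of equivalence classes of rays is infinite).
  InfinitelyManyEnds : Set
  InfinitelyManyEnds =
    ∀ (n : ℕ) → Σ (Fin n → Ray) λ R → ∀ i j → i ≢ j → ¬ EquivRays (R i) (R j)

  Connected : Set
  Connected = ∀ u v → Σ Path λ P → (start P ≡ u) × (end P ≡ v)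

  LocallyFinite : Set
  LocallyFinite = ∀ v → Σ (List V) λ ns → ∀ w → (v ~ w → w ∈ ns) × (w ∈ ns → v ~ w)

  record Automorphism : Set where
    field
      perm : V ↔ V
      pres : ∀ {u v} → u ~ v → Inverse.to perm u ~ Inverse.to perm v
      refl~ : ∀ {u v} → Inverse.to perm u ~ Inverse.to perm v → u ~ v

  aut : Automorphism → V → V
  aut φ = Inverse.to (Automorphism.perm φ)

  FinitelyManyOrbits : (Automorphism → Set) → Set
  FinitelyManyOrbits H =
    Σ (List V) λ reps → ∀ v → ∃[ r ] (r ∈ reps) × (∃[ φ ] H φ × (aut φ r ≡ v))

  QuasiTransitive : Set
  QuasiTransitive = FinitelyManyOrbits (λ _ → ⊤)

  Proper : (k : ℕ) → (V → Fin k) → Set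
  Proper k c = ∀ {u v} → u ~ v → c u ≢ c v

  Periodic : (k : ℕ) → (V → Fin k) → Set
  Periodic k c = FinitelyManyOrbits (λ φ → ∀ v → c (aut φ v) ≡ c v)

  HasPeriodicProperColouring : ℕ → Set
  HasPeriodicProperColouring k = Σ (V → Fin k) λ c → Proper k c × Periodic k c

  ChromaticNumber≡ : ℕ → Set
  ChromaticNumber≡ k =
    (Σ (V → Fin k) (Proper k)) × (∀ m → m < k → ¬ Σ (V → Fin m) (Proper m))

  AtLeastNeighbours : V → ℕ → Set
  AtLeastNeighbours v d = Σ (Fin d → V) λ f → Injective _≡_ _≡_ f × (∀ i → v ~ f i)

  MaxDegree≡ : ℕ → Set
  MaxDegree≡ d = (∀ v → ¬ AtLeastNeighbours v (suc d)) × (∃[ v ] AtLeastNeighbours v d)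

-- The graph is the 3-regular tree with a distinguished end in which every node x is replaced by a
-- gadget: a stem s joined to the node vertex of x and to two triangles p i , q i , r i, where the node
-- vertex of the i-th child of x is joined to p i, q i and r (not i). Colouring node vertices by their
-- last address bit is a proper 3-colouring, and colouring by slot is a proper 4-colouring invariant
-- under the lifts of the end-fixing tree automorphisms, which are transitive on nodes. In a proper
-- 3-colouring, however, the triangle p false , q false , r false uses all three colours, so the two
-- children of every node are coloured differently. Node vertices and the child relation can be
-- recognised from triangles, so a colour-preserving automorphism commutes with the descent map
-- "go to the child of smaller colour". The other child u of the origin is no descent image, so the
-- iterates descentⁿ u lie in pairwise different orbits. Finally, the subtree below each node of level
-- 0 hangs on a single stem edge, which separates rays and yields infinitely many ends.

{-# OPTIONS --safe #-}
module Submission where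

open import Defs
open import Algebra.Properties.AbelianGroup using (//-rightDividesˡ; //-rightDividesʳ)
open import Data.Bool as Bool using (Bool; true; false; not; _xor_)
open import Data.Bool.Properties using (xor-comm; xor-identityʳ; not-distribˡ-xor; not-involutive; ¬-not; not-¬)
open import Data.Empty using (⊥-elim)
open import Data.Fin using (Fin; zero; suc; inject₁; fromℕ; toℕ; _<?_)
open import Data.Fin.Properties using (pigeonhole; injective⇒≤; <-cmp; <-asym; toℕ-injective)
open import Data.Integer as ℤ using (ℤ; +_; -[1+_]; +0; -_)
open import Data.Integer.Properties as ℤ using (suc-pred; pred-suc; i≢suc[i]; +-0-abelianGroup)
open import Data.List using (List; []; _∷_; length; lookup; map)
open import Data.List.Properties using (length-map)
open import Data.List.Membership.Propositional using (_∈_)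
open import Data.List.Membership.Propositional.Properties using (∈-lookup)
open import Data.List.Relation.Unary.All as All using (All)
open import Data.List.Relation.Unary.All.Properties using (¬Any⇒All¬)
open import Data.List.Relation.Unary.AllPairs as AllPairs using (AllPairs; []; _∷_)
open import Data.List.Relation.Unary.AllPairs.Properties using () renaming (map⁺ to allPairs-map⁺)
open import Data.List.Relation.Unary.Any as Any using (here; there)
open import Data.List.Relation.Unary.Any.Properties using (lookup-index)
open import Data.List.Relation.Unary.Linked using (Linked; [-]; _∷_)
open import Data.List.Relation.Unary.Unique.Propositional using (Unique)
open import Data.Maybe using (Maybe; just; nothing)
open import Data.Maybe.Properties as Maybe using (just-injective)
open import Data.Nat as ℕ using (ℕ; zero; suc; _+_; _<_; _≤_)
open import Data.Nat.GeneralisedArithmetic using (fold; fold-+; iterate)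
open import Data.Nat.Properties as ℕ using (n<1+n; ≤-refl; ≤-trans; n≤1+n; 1+n≰n; <⇒≱)
open import Data.Product using (Σ; ∃; ∃-syntax; ∃₂; _×_; _,_; proj₁; proj₂)
open import Data.Product.Properties using () renaming (≡-dec to ×-≡-dec)
open import Data.Sum as Sum using (_⊎_; inj₁; inj₂)
open import Data.Unit using (tt)
open import Function using (_∘_)
open import Function.Bundles using (_↔_; Inverse; mk↔ₛ′; mk↣)
open import Function.Construct.Composition using (_↔-∘_)
open import Function.Construct.Symmetry using (↔-sym)
open import Function.Definitions using (Injective)
open import Relation.Binary.Definitions using (DecidableEquality; tri<; tri≈; tri>)
open import Relation.Binary.PropositionalEquality
  using (_≡_; _≢_; refl; sym; trans; cong; cong₂; subst; subst₂; module ≡-Reasoning)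
open import Relation.Nullary using (¬_; Dec; yes; no; does)
open import Relation.Nullary.Decidable using (dec-true; dec-false; map′; via-injection)

lookup-injective : ∀ {A : Set} {xs : List A} → Unique xs → Injective _≡_ _≡_ (lookup xs)
lookup-injective {xs = x ∷ xs} (_ ∷ u) {zero} {zero} _ = refl
lookup-injective {xs = x ∷ xs} (x∉ ∷ u) {zero} {suc j} eq = ⊥-elim (All.lookup x∉ (∈-lookup j) eq)
lookup-injective {xs = x ∷ xs} (x∉ ∷ u) {suc i} {zero} eq = ⊥-elim (All.lookup x∉ (∈-lookup i) (sym eq))
lookup-injective {xs = x ∷ xs} (_ ∷ u) {suc i} {suc j} eq = cong suc (lookup-injective u eq)

∈-index-injective : ∀ {A : Set} {xs : List A} {x y} (x∈ : x ∈ xs) (y∈ : y ∈ xs)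
                  → Any.index x∈ ≡ Any.index y∈ → x ≡ y
∈-index-injective {xs = xs} x∈ y∈ eq = trans (lookup-index x∈) (trans (cong (lookup xs) eq) (sym (lookup-index y∈)))

linked-lookup : ∀ {A : Set} {R : A → A → Set} {u xs} → Linked R (u ∷ xs)
  → ∀ (i : Fin (length xs)) → R (lookup (u ∷ xs) (inject₁ i)) (lookup (u ∷ xs) (suc i))
linked-lookup {xs = x ∷ xs} (r ∷ _) zero = r
linked-lookup {xs = x ∷ xs} (_ ∷ l) (suc i) = linked-lookup l i

lastOf : ∀ {A : Set} → A → List A → A
lastOf u [] = u
lastOf u (x ∷ xs) = lastOf x xs

lookup-last : ∀ {A : Set} (u : A) xs → lookup (u ∷ xs) (fromℕ (length xs)) ≡ lastOf u xs
lookup-last u [] = refl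
lookup-last u (x ∷ xs) = lookup-last x xs

unique-length≤ : ∀ {m} {xs : List (Fin m)} → Unique xs → length xs ≤ m
unique-length≤ u = injective⇒≤ (lookup-injective u)

fold-injective : ∀ {X : Set} {f : X → X} → Injective _≡_ _≡_ f → ∀ n {x y} → fold x f n ≡ fold y f n → x ≡ y
fold-injective f-injective zero eq = eq
fold-injective f-injective (suc n) eq = fold-injective f-injective n (f-injective eq)

fold-commute : ∀ {X : Set} {f g : X → X} → (∀ x → g (f x) ≡ f (g x)) → ∀ x n → g (fold x f n) ≡ fold (g x) f n
fold-commute gf x zero = refl
fold-commute {f = f} gf x (suc n) = trans (gf _) (cong f (fold-commute gf x n))

commuting-map-cannot-advance : ∀ {X : Set} {f g h : X → X} {u : X} → Injective _≡_ _≡_ f → (∀ x → f x ≢ u)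
  → (∀ x → h (g x) ≡ x) → (∀ x → g (f x) ≡ f (g x)) → (∀ x → h (f x) ≡ f (h x))
  → ∀ {m n} → m < n → g (fold u f m) ≢ fold u f n
commuting-map-cannot-advance {f = f} {g} {h} {u} f-injective u∉f hg gf hf {m} {n} m<n advances =
  u∉f (h (fold u f k)) (sym u≡)
  where
  open ≡-Reasoning
  k = proj₁ (ℕ.m≤n⇒∃[o]m+o≡n m<n)
  n≡m+1+k : n ≡ m + suc k
  n≡m+1+k = sym (trans (ℕ.+-suc m k) (proj₂ (ℕ.m≤n⇒∃[o]m+o≡n m<n)))
  gu≡ : g u ≡ f (fold u f k)
  gu≡ = fold-injective f-injective m (begin
    fold (g u) f m               ≡⟨ sym (fold-commute gf u m) ⟩
    g (fold u f m)               ≡⟨ advances ⟩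
    fold u f n                   ≡⟨ cong (fold u f) n≡m+1+k ⟩
    fold u f (m + suc k)         ≡⟨ fold-+ u f m ⟩
    fold (fold u f (suc k)) f m  ∎)
  u≡ : u ≡ f (h (fold u f k))
  u≡ = begin
    u                  ≡⟨ sym (hg u) ⟩
    h (g u)            ≡⟨ cong h gu≡ ⟩
    h (f (fold u f k)) ≡⟨ hf _ ⟩
    f (h (fold u f k)) ∎

smallerOf : ∀ {n} → (Bool → Fin n) → Bool
smallerOf g = does (g true <? g false)

<?-flip : ∀ {n} {a b : Fin n} → a ≢ b → does (b <? a) ≡ not (does (a <? b))
<?-flip {a = a} {b} a≢b with <-cmp a b
... | tri< a<b _ _ = trans (dec-false (b <? a) (<-asym a<b)) (cong not (sym (dec-true (a <? b) a<b)))
... | tri≈ _ a≡b _ = ⊥-elim (a≢b a≡b)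
... | tri> _ _ b<a = trans (dec-true (b <? a) b<a) (cong not (sym (dec-false (a <? b) (<-asym b<a))))

smallerOf-twist : ∀ {n} {g g′ : Bool → Fin n} b → g true ≢ g false → (∀ i → g′ (i xor b) ≡ g i)
                → smallerOf g′ ≡ smallerOf g xor b
smallerOf-twist false _ same =
  trans (cong₂ (λ u v → does (u <? v)) (same true) (same false)) (sym (xor-identityʳ _))
smallerOf-twist {g = g} {g′} true apart same = begin
  does (g′ true <? g′ false)  ≡⟨ cong₂ (λ u v → does (u <? v)) (same false) (same true) ⟩
  does (g false <? g true)    ≡⟨ <?-flip apart ⟩
  not (smallerOf g)           ≡⟨ xor-comm true (smallerOf g) ⟩
  smallerOf g xor true        ∎
  where open ≡-Reasoning

module GraphTheory (G : Graph) where
  open Graph G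

  mkAutomorphism : (f : V ↔ V) → (∀ {u v} → u ~ v → Inverse.to f u ~ Inverse.to f v)
                 → (∀ {u v} → u ~ v → Inverse.from f u ~ Inverse.from f v) → Automorphism G
  mkAutomorphism f to~ from~ = record
    { perm = f ; pres = to~
    ; refl~ = λ e → subst₂ _~_ (Inverse.strictlyInverseʳ f _) (Inverse.strictlyInverseʳ f _) (from~ e) }

  _∘ᴬ_ : Automorphism G → Automorphism G → Automorphism G
  φ ∘ᴬ ψ = record
    { perm = Automorphism.perm φ ↔-∘ Automorphism.perm ψ
    ; pres = Automorphism.pres φ ∘ Automorphism.pres ψ
    ; refl~ = Automorphism.refl~ ψ ∘ Automorphism.refl~ φ }

  _⁻¹ᴬ : Automorphism G → Automorphism G
  φ ⁻¹ᴬ = mkAutomorphism (↔-sym perm) from~ pres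
    where
    open Automorphism φ
    from~ : ∀ {u v} → u ~ v → Inverse.from perm u ~ Inverse.from perm v
    from~ e = refl~ (subst₂ _~_ (sym (Inverse.strictlyInverseˡ perm _)) (sym (Inverse.strictlyInverseˡ perm _)) e)

  aut-inverseˡ : ∀ φ v → aut G (φ ⁻¹ᴬ) (aut G φ v) ≡ v
  aut-inverseˡ φ = Inverse.strictlyInverseʳ (Automorphism.perm φ)

  aut-injective : ∀ φ → Injective _≡_ _≡_ (aut G φ)
  aut-injective φ {u} {v} eq = begin
    u                            ≡⟨ sym (aut-inverseˡ φ u) ⟩
    aut G (φ ⁻¹ᴬ) (aut G φ u)    ≡⟨ cong (aut G (φ ⁻¹ᴬ)) eq ⟩
    aut G (φ ⁻¹ᴬ) (aut G φ v)    ≡⟨ aut-inverseˡ φ v ⟩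
    v                            ∎
    where open ≡-Reasoning

  PreservesColouring : ∀ {k} → (V → Fin k) → Automorphism G → Set
  PreservesColouring c φ = ∀ v → c (aut G φ v) ≡ c v

  module _ {k} {c : V → Fin k} where

    ∘ᴬ-preservesColouring : ∀ {φ ψ} → PreservesColouring c φ → PreservesColouring c ψ
                          → PreservesColouring c (φ ∘ᴬ ψ)
    ∘ᴬ-preservesColouring cφ cψ v = trans (cφ _) (cψ v)

    ⁻¹ᴬ-preservesColouring : ∀ {φ} → PreservesColouring c φ → PreservesColouring c (φ ⁻¹ᴬ)
    ⁻¹ᴬ-preservesColouring {φ} cφ v =
      trans (sym (cφ _)) (cong c (Inverse.strictlyInverseˡ (Automorphism.perm φ) v))

    periodic-sequence-recurs : Periodic G k c → (v : ℕ → V)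
      → ∃₂ λ i j → i < j × Σ (Automorphism G) λ φ → PreservesColouring c φ × aut G φ (v i) ≡ v j
    periodic-sequence-recurs (reps , cover) v = recurs (pigeonhole (n<1+n (length reps)) repIndex)
      where
      repIndex : Fin (suc (length reps)) → Fin (length reps)
      repIndex t = Any.index (proj₁ (proj₂ (cover (v (toℕ t)))))
      recurs : (∃₂ λ i j → toℕ i < toℕ j × repIndex i ≡ repIndex j)
        → ∃₂ λ i j → i < j × Σ (Automorphism G) λ φ → PreservesColouring c φ × aut G φ (v i) ≡ v j
      recurs (i , j , i<j , same) with cover (v (toℕ i)) | cover (v (toℕ j))
      ... | rᵢ , rᵢ∈ , φᵢ , cφᵢ , φᵢrᵢ | rⱼ , rⱼ∈ , φⱼ , cφⱼ , φⱼrⱼ =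
        toℕ i , toℕ j , i<j , φⱼ ∘ᴬ (φᵢ ⁻¹ᴬ) ,
        ∘ᴬ-preservesColouring {φⱼ} {φᵢ ⁻¹ᴬ} cφⱼ (⁻¹ᴬ-preservesColouring {φᵢ} cφᵢ) , (begin
          aut G φⱼ (aut G (φᵢ ⁻¹ᴬ) (v (toℕ i)))    ≡⟨ cong (aut G φⱼ ∘ aut G (φᵢ ⁻¹ᴬ)) (sym φᵢrᵢ) ⟩
          aut G φⱼ (aut G (φᵢ ⁻¹ᴬ) (aut G φᵢ rᵢ))  ≡⟨ cong (aut G φⱼ) (aut-inverseˡ φᵢ rᵢ) ⟩
          aut G φⱼ rᵢ                              ≡⟨ cong (aut G φⱼ) (∈-index-injective rᵢ∈ rⱼ∈ same) ⟩
          aut G φⱼ rⱼ                              ≡⟨ φⱼrⱼ ⟩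
          v (toℕ j)                                ∎)
        where open ≡-Reasoning

  neighbours≤ : ∀ {v d} (ns : List V) → (∀ {w} → v ~ w → w ∈ ns) → AtLeastNeighbours G v d → d ≤ length ns
  neighbours≤ ns listed (f , f-injective , adj) =
    injective⇒≤ λ {i} {j} → f-injective ∘ ∈-index-injective (listed (adj i)) (listed (adj j))

  distinct-neighbours : ∀ {v} (ns : List V) → Unique ns → (∀ {w} → w ∈ ns → v ~ w)
                      → AtLeastNeighbours G v (length ns)
  distinct-neighbours ns distinct adj = lookup ns , lookup-injective distinct , adj ∘ ∈-lookup

  clique-length≤ : ∀ {m} {c : V → Fin m} {vs} → Proper G m c → AllPairs _~_ vs → length vs ≤ m
  clique-length≤ {c = c} {vs} proper clique =
    subst (_≤ _) (length-map c vs) (unique-length≤ (allPairs-map⁺ (AllPairs.map proper clique)))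

  data Walk : V → V → Set where
    []  : ∀ {v} → Walk v v
    _∷_ : ∀ {u w v} → u ~ w → Walk w v → Walk u v

  _++ʷ_ : ∀ {u w v} → Walk u w → Walk w v → Walk u v
  [] ++ʷ q = q
  (e ∷ p) ++ʷ q = e ∷ (p ++ʷ q)

  reverseʷ : ∀ {u v} → Walk u v → Walk v u
  reverseʷ [] = []
  reverseʷ (e ∷ p) = reverseʷ p ++ʷ (~-sym e ∷ [])

  record SimplePath (u v : V) : Set where
    field
      rest   : List V
      linked : Linked _~_ (u ∷ rest)
      unique : Unique (u ∷ rest)
      ends   : lastOf u rest ≡ v

  suffixFrom : ∀ {u w v} (P : SimplePath w v) → u ∈ (w ∷ SimplePath.rest P) → SimplePath u v
  suffixFrom P (here refl) = P
  suffixFrom record { rest = x ∷ xs ; linked = _ ∷ l ; unique = _ ∷ un ; ends = e } (there u∈) =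
    suffixFrom record { rest = xs ; linked = l ; unique = un ; ends = e } u∈

  simplePath⇒path : ∀ {u v} → SimplePath u v → Σ (Path G) λ P → start G P ≡ u × end G P ≡ v
  simplePath⇒path {u} record { rest = xs ; linked = l ; unique = un ; ends = e } =
    record { len = length xs ; vtx = lookup (u ∷ xs) ; adj = linked-lookup l ; inj = lookup-injective un }
    , refl , trans (lookup-last u xs) e

  module _ (_≟_ : DecidableEquality V) where
    open import Data.List.Membership.DecPropositional _≟_ using (_∈?_)

    prepend : ∀ {u w v} → u ~ w → SimplePath w v → SimplePath u v
    prepend {u} {w} e P with u ∈? (w ∷ SimplePath.rest P)
    ... | yes u∈ = suffixFrom P u∈
    ... | no u∉ = record
      { rest = w ∷ rest ; linked = e ∷ linked ; unique = ¬Any⇒All¬ (w ∷ rest) u∉ ∷ unique ; ends = ends }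
      where open SimplePath P

    walk⇒simplePath : ∀ {u v} → Walk u v → SimplePath u v
    walk⇒simplePath [] = record { rest = [] ; linked = [-] ; unique = All.[] ∷ [] ; ends = refl }
    walk⇒simplePath (e ∷ p) = prepend e (walk⇒simplePath p)

    rooted⇒connected : (root : V) → (∀ v → Walk v root) → Connected G
    rooted⇒connected root walk u v = simplePath⇒path (walk⇒simplePath (walk u ++ʷ reverseʷ (walk v)))

  module _ {D : V → Set} (D? : ∀ v → Dec (D v)) {κ : V}
           (exit : ∀ {u w} → u ~ w → D u → ¬ D w → u ≡ κ) where

    leaving-visits : ∀ n (vt : Fin (suc n) → V) → (∀ (i : Fin n) → vt (inject₁ i) ~ vt (suc i))
                   → D (vt zero) → ¬ D (vt (fromℕ n)) → ∃ λ t → vt t ≡ κ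
    leaving-visits zero vt adj inside outside = ⊥-elim (outside inside)
    leaving-visits (suc n) vt adj inside outside with D? (vt (suc zero))
    ... | no next-outside = zero , exit (adj zero) inside next-outside
    ... | yes next-inside =
      let t , visit = leaving-visits n (vt ∘ suc) (adj ∘ suc) next-inside outside in suc t , visit

    separated-rays-inequivalent : (R S : Ray G) → (∀ n → D (Ray.seq R n)) → (∀ n → ¬ D (Ray.seq S n))
                                → ¬ EquivRays G R S
    separated-rays-inequivalent R S R-inside S-outside (P , P-ends , P-disjoint) =
      let t₀ , visit₀ = visits 0
          t₁ , visit₁ = visits 1
      in P-disjoint 0 1 (λ ()) t₀ t₁ (trans visit₀ (sym visit₁))
      where
      visits : ∀ i → ∃ λ t → Path.vtx (P i) t ≡ κ
      visits i =
        let (j , from-R) , (k , to-S) = P-ends i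
        in leaving-visits (Path.len (P i)) (Path.vtx (P i)) (Path.adj (P i))
             (subst D (sym from-R) (R-inside j)) (λ inside → S-outside k (subst D to-S inside))

  InTriangle : V → Set
  InTriangle v = ∃₂ λ a b → v ~ a × v ~ b × a ~ b

  OnTwoTriangles : V → Set
  OnTwoTriangles v = Σ V λ a → ∃₂ λ b d → v ~ a × v ~ b × v ~ d × a ~ b × a ~ d × b ≢ d

  module _ (φ : Automorphism G) where
    private
      f = aut G φ
      f~ = Automorphism.pres φ

    inTriangle-aut : ∀ {v} → InTriangle v → InTriangle (f v)
    inTriangle-aut (a , b , va , vb , ab) = f a , f b , f~ va , f~ vb , f~ ab

    onTwoTriangles-aut : ∀ {v} → OnTwoTriangles v → OnTwoTriangles (f v)
    onTwoTriangles-aut (a , b , d , va , vb , vd , ab , ad , b≢d) =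
      f a , f b , f d , f~ va , f~ vb , f~ vd , f~ ab , f~ ad , b≢d ∘ aut-injective φ

  reflects-aut : (P : V → Set) → (∀ φ {v} → P v → P (aut G φ v)) → ∀ φ {v} → P (aut G φ v) → P v
  reflects-aut P preserves φ {v} = subst P (aut-inverseˡ φ v) ∘ preserves (φ ⁻¹ᴬ)

-- The tree

-- Addresses are natural numbers in binary, a positive one being its bit string after the leading 1:
-- push a i = 2a + i, pop a = ⌊a/2⌋ and lastBit a is the parity of a.
data Bits : Set where
  one : Bits
  _O _I : Bits → Bits

data Addr : Set where
  zero : Addr
  pos  : Bits → Addr

push : Addr → Bool → Addr
push zero false = zero
push zero true = pos one
push (pos b) false = pos (b O)
push (pos b) true = pos (b I)

pop : Addr → Addr
pop zero = zero
pop (pos one) = zero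
pop (pos (b O)) = pos b
pop (pos (b I)) = pos b

lastBit : Addr → Bool
lastBit zero = false
lastBit (pos one) = true
lastBit (pos (b O)) = false
lastBit (pos (b I)) = true

pop-push : ∀ a i → pop (push a i) ≡ a
pop-push zero false = refl
pop-push zero true = refl
pop-push (pos b) false = refl
pop-push (pos b) true = refl

lastBit-push : ∀ a i → lastBit (push a i) ≡ i
lastBit-push zero false = refl
lastBit-push zero true = refl
lastBit-push (pos b) false = refl
lastBit-push (pos b) true = refl

push-pop : ∀ a → push (pop a) (lastBit a) ≡ a
push-pop zero = refl
push-pop (pos one) = refl
push-pop (pos (b O)) = refl
push-pop (pos (b I)) = refl

infixl 6 _⊕_ _⊕ᵇ_

_⊕ᵇ_ : Bits → Bits → Addr
_⊕_ : Addr → Addr → Addr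
zero ⊕ b = b
pos x ⊕ zero = pos x
pos x ⊕ pos y = x ⊕ᵇ y
one ⊕ᵇ one = zero
one ⊕ᵇ (y O) = pos (y I)
one ⊕ᵇ (y I) = pos (y O)
(x O) ⊕ᵇ one = pos (x I)
(x I) ⊕ᵇ one = pos (x O)
(x O) ⊕ᵇ (y O) = push (x ⊕ᵇ y) false
(x O) ⊕ᵇ (y I) = push (x ⊕ᵇ y) true
(x I) ⊕ᵇ (y O) = push (x ⊕ᵇ y) true
(x I) ⊕ᵇ (y I) = push (x ⊕ᵇ y) false

push-⊕ : ∀ a b i j → push a i ⊕ push b j ≡ push (a ⊕ b) (i xor j)
push-⊕ zero zero false false = refl
push-⊕ zero zero false true = refl
push-⊕ zero zero true false = refl
push-⊕ zero zero true true = refl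
push-⊕ zero (pos y) false false = refl
push-⊕ zero (pos y) false true = refl
push-⊕ zero (pos y) true false = refl
push-⊕ zero (pos y) true true = refl
push-⊕ (pos x) zero false false = refl
push-⊕ (pos x) zero false true = refl
push-⊕ (pos x) zero true false = refl
push-⊕ (pos x) zero true true = refl
push-⊕ (pos x) (pos y) false false = refl
push-⊕ (pos x) (pos y) false true = refl
push-⊕ (pos x) (pos y) true false = refl
push-⊕ (pos x) (pos y) true true = refl

⊕ᵇ-self : ∀ x → x ⊕ᵇ x ≡ zero
⊕ᵇ-self one = refl
⊕ᵇ-self (x O) = cong (λ z → push z false) (⊕ᵇ-self x)
⊕ᵇ-self (x I) = cong (λ z → push z false) (⊕ᵇ-self x)

⊕ᵇ-cancelʳ : ∀ x y → (x ⊕ᵇ y) ⊕ pos y ≡ pos x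
⊕ᵇ-cancelʳ one one = refl
⊕ᵇ-cancelʳ one (y O) = cong (λ z → push z true) (⊕ᵇ-self y)
⊕ᵇ-cancelʳ one (y I) = cong (λ z → push z true) (⊕ᵇ-self y)
⊕ᵇ-cancelʳ (x O) one = refl
⊕ᵇ-cancelʳ (x I) one = refl
⊕ᵇ-cancelʳ (x O) (y O) = trans (push-⊕ (x ⊕ᵇ y) (pos y) false false) (cong (λ z → push z false) (⊕ᵇ-cancelʳ x y))
⊕ᵇ-cancelʳ (x O) (y I) = trans (push-⊕ (x ⊕ᵇ y) (pos y) true true) (cong (λ z → push z false) (⊕ᵇ-cancelʳ x y))
⊕ᵇ-cancelʳ (x I) (y O) = trans (push-⊕ (x ⊕ᵇ y) (pos y) true false) (cong (λ z → push z true) (⊕ᵇ-cancelʳ x y))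
⊕ᵇ-cancelʳ (x I) (y I) = trans (push-⊕ (x ⊕ᵇ y) (pos y) false true) (cong (λ z → push z true) (⊕ᵇ-cancelʳ x y))

⊕-cancelʳ : ∀ a c → a ⊕ c ⊕ c ≡ a
⊕-cancelʳ zero zero = refl
⊕-cancelʳ zero (pos y) = ⊕ᵇ-self y
⊕-cancelʳ (pos x) zero = refl
⊕-cancelʳ (pos x) (pos y) = ⊕ᵇ-cancelʳ x y

_≟ᵇ_ : DecidableEquality Bits
one ≟ᵇ one = yes refl
one ≟ᵇ (y O) = no λ ()
one ≟ᵇ (y I) = no λ ()
(x O) ≟ᵇ one = no λ ()
(x O) ≟ᵇ (y O) = map′ (cong _O) (λ { refl → refl }) (x ≟ᵇ y)
(x O) ≟ᵇ (y I) = no λ ()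
(x I) ≟ᵇ one = no λ ()
(x I) ≟ᵇ (y O) = no λ ()
(x I) ≟ᵇ (y I) = map′ (cong _I) (λ { refl → refl }) (x ≟ᵇ y)

_≟ᵃ_ : DecidableEquality Addr
zero ≟ᵃ zero = yes refl
zero ≟ᵃ pos y = no λ ()
pos x ≟ᵃ zero = no λ ()
pos x ≟ᵃ pos y = map′ (cong pos) (λ { refl → refl }) (x ≟ᵇ y)

-- The node (k , a) has parent (k + 1 , ⌊a/2⌋) and children (k - 1 , 2a + i); the spine (k , 0)
-- runs to the distinguished end.
Node : Set
Node = ℤ × Addr

origin : Node
origin = +0 , zero

child : Bool → Node → Node
child i (k , a) = ℤ.pred k , push a i

parent : Node → Node
parent (k , a) = ℤ.suc k , pop a

bit : Node → Bool
bit (k , a) = lastBit a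

parent-child : ∀ i x → parent (child i x) ≡ x
parent-child i (k , a) = cong₂ _,_ (suc-pred k) (pop-push a i)

bit-child : ∀ i x → bit (child i x) ≡ i
bit-child i (k , a) = lastBit-push a i

child-parent : ∀ x → child (bit x) (parent x) ≡ x
child-parent (k , a) = cong₂ _,_ (pred-suc k) (push-pop a)

child-injective : ∀ {i j x y} → child i x ≡ child j y → i ≡ j × x ≡ y
child-injective {i} {j} {x} {y} eq =
  trans (sym (bit-child i x)) (trans (cong bit eq) (bit-child j y)) ,
  trans (sym (parent-child i x)) (trans (cong parent eq) (parent-child j y))

child≢ : ∀ i x → child i x ≢ x
child≢ i (k , a) eq = i≢suc[i] (trans (sym (suc-pred k)) (cong ℤ.suc (cong proj₁ eq)))

-- The graph

data Slot : Set where
  nd s  : Slot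
  p q r : Bool → Slot

Vertex : Set
Vertex = Node × Slot

-- Children are given by an equation so that matching on an edge never unifies with child i x.
data Edge : Vertex → Vertex → Set where
  nd-s    : ∀ {x} → Edge (x , nd) (x , s)
  s-p     : ∀ {x i} → Edge (x , s) (x , p i)
  p-q     : ∀ {x i} → Edge (x , p i) (x , q i)
  q-r     : ∀ {x i} → Edge (x , q i) (x , r i)
  r-p     : ∀ {x i} → Edge (x , r i) (x , p i)
  p-child : ∀ {x y i} → y ≡ child i x → Edge (x , p i) (y , nd)
  q-child : ∀ {x y i} → y ≡ child i x → Edge (x , q i) (y , nd)
  r-child : ∀ {x y i} → y ≡ child (not i) x → Edge (x , r i) (y , nd)

Adj : Vertex → Vertex → Set
Adj u w = Edge u w ⊎ Edge w u

Adj-sym : ∀ {u w} → Adj u w → Adj w u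
Adj-sym = Sum.swap

Adj-irrefl : ∀ {v} → ¬ Adj v v
Adj-irrefl (inj₁ ())
Adj-irrefl (inj₂ ())

G : Graph
G = record { V = Vertex ; _~_ = Adj ; ~-sym = Adj-sym ; ~-irr = Adj-irrefl }

open GraphTheory G

slotCode : Slot → ℕ × Bool
slotCode nd = 0 , false
slotCode s = 1 , false
slotCode (p i) = 2 , i
slotCode (q i) = 3 , i
slotCode (r i) = 4 , i

slotDecode : ℕ × Bool → Slot
slotDecode (0 , _) = nd
slotDecode (1 , _) = s
slotDecode (2 , i) = p i
slotDecode (3 , i) = q i
slotDecode (_ , i) = r i

slotDecode-slotCode : ∀ σ → slotDecode (slotCode σ) ≡ σ
slotDecode-slotCode nd = refl
slotDecode-slotCode s = refl
slotDecode-slotCode (p i) = refl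
slotDecode-slotCode (q i) = refl
slotDecode-slotCode (r i) = refl

_≟ˢ_ : DecidableEquality Slot
_≟ˢ_ = via-injection (mk↣ slotCode-injective) (×-≡-dec ℕ._≟_ Bool._≟_)
  where
  slotCode-injective : Injective _≡_ _≡_ slotCode
  slotCode-injective {σ} {τ} eq =
    trans (sym (slotDecode-slotCode σ)) (trans (cong slotDecode eq) (slotDecode-slotCode τ))

_≟ⱽ_ : DecidableEquality Vertex
_≟ⱽ_ = ×-≡-dec (×-≡-dec ℤ._≟_ _≟ᵃ_) _≟ˢ_

neighbours : Vertex → List Vertex
neighbours (x , nd) = (x , s) ∷ (parent x , p (bit x)) ∷ (parent x , q (bit x)) ∷ (parent x , r (not (bit x))) ∷ []
neighbours (x , s) = (x , nd) ∷ (x , p false) ∷ (x , p true) ∷ []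
neighbours (x , p i) = (x , s) ∷ (x , q i) ∷ (x , r i) ∷ (child i x , nd) ∷ []
neighbours (x , q i) = (x , p i) ∷ (x , r i) ∷ (child i x , nd) ∷ []
neighbours (x , r i) = (x , q i) ∷ (x , p i) ∷ (child (not i) x , nd) ∷ []

seen-from-child : ∀ (σ : Bool → Slot) i x → (x , σ i) ≡ (parent (child i x) , σ (bit (child i x)))
seen-from-child σ i x = sym (cong₂ _,_ (parent-child i x) (cong σ (bit-child i x)))

neighbours-complete : ∀ {v w} → Adj v w → w ∈ neighbours v
neighbours-complete (inj₁ nd-s) = here refl
neighbours-complete (inj₁ (s-p {i = false})) = there (here refl)
neighbours-complete (inj₁ (s-p {i = true})) = there (there (here refl))
neighbours-complete (inj₁ p-q) = there (here refl)
neighbours-complete (inj₁ q-r) = there (here refl)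
neighbours-complete (inj₁ r-p) = there (here refl)
neighbours-complete (inj₁ (p-child refl)) = there (there (there (here refl)))
neighbours-complete (inj₁ (q-child refl)) = there (there (here refl))
neighbours-complete (inj₁ (r-child refl)) = there (there (here refl))
neighbours-complete (inj₂ nd-s) = here refl
neighbours-complete (inj₂ s-p) = here refl
neighbours-complete (inj₂ p-q) = here refl
neighbours-complete (inj₂ q-r) = here refl
neighbours-complete (inj₂ r-p) = there (there (here refl))
neighbours-complete (inj₂ (p-child {x} {i = i} refl)) = there (here (seen-from-child p i x))
neighbours-complete (inj₂ (q-child {x} {i = i} refl)) = there (there (here (seen-from-child q i x)))
neighbours-complete (inj₂ (r-child {x} {i = i} refl)) =
  there (there (there (here (trans (cong (λ j → x , r j) (sym (not-involutive i)))
                                   (seen-from-child (r ∘ not) (not i) x)))))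

neighbours-sound : ∀ {v w} → w ∈ neighbours v → Adj v w
neighbours-sound {x , nd} (here refl) = inj₁ nd-s
neighbours-sound {x , nd} (there (here refl)) = inj₂ (p-child (sym (child-parent x)))
neighbours-sound {x , nd} (there (there (here refl))) = inj₂ (q-child (sym (child-parent x)))
neighbours-sound {x , nd} (there (there (there (here refl)))) =
  inj₂ (r-child (sym (trans (cong (λ j → child j (parent x)) (not-involutive (bit x))) (child-parent x))))
neighbours-sound {x , s} (here refl) = inj₂ nd-s
neighbours-sound {x , s} (there (here refl)) = inj₁ s-p
neighbours-sound {x , s} (there (there (here refl))) = inj₁ s-p
neighbours-sound {x , p i} (here refl) = inj₂ s-p
neighbours-sound {x , p i} (there (here refl)) = inj₁ p-q
neighbours-sound {x , p i} (there (there (here refl))) = inj₂ r-p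
neighbours-sound {x , p i} (there (there (there (here refl)))) = inj₁ (p-child refl)
neighbours-sound {x , q i} (here refl) = inj₂ p-q
neighbours-sound {x , q i} (there (here refl)) = inj₁ q-r
neighbours-sound {x , q i} (there (there (here refl))) = inj₁ (q-child refl)
neighbours-sound {x , r i} (here refl) = inj₂ q-r
neighbours-sound {x , r i} (there (here refl)) = inj₁ r-p
neighbours-sound {x , r i} (there (there (here refl))) = inj₁ (r-child refl)

locallyFinite : LocallyFinite G
locallyFinite v = neighbours v , λ w → neighbours-complete , neighbours-sound

neighbours-length≤4 : ∀ v → length (neighbours v) ≤ 4
neighbours-length≤4 (x , nd) = ≤-refl
neighbours-length≤4 (x , s) = n≤1+n 3
neighbours-length≤4 (x , p i) = ≤-refl
neighbours-length≤4 (x , q i) = n≤1+n 3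
neighbours-length≤4 (x , r i) = n≤1+n 3

maxDegree : MaxDegree≡ G 4
maxDegree =
  (λ v five → 1+n≰n (≤-trans (neighbours≤ (neighbours v) neighbours-complete five) (neighbours-length≤4 v))) ,
  (origin , nd) , distinct-neighbours (neighbours (origin , nd)) distinct neighbours-sound
  where
  distinct : Unique (neighbours (origin , nd))
  distinct = ((λ ()) All.∷ (λ ()) All.∷ (λ ()) All.∷ All.[]) ∷ ((λ ()) All.∷ (λ ()) All.∷ All.[])
           ∷ ((λ ()) All.∷ All.[]) ∷ All.[] ∷ []

edgewise-proper : ∀ {k} {c : Vertex → Fin k} → (∀ {u w} → Edge u w → c u ≢ c w) → Proper G k c
edgewise-proper proper (inj₁ e) = proper e
edgewise-proper proper (inj₂ e) = proper e ∘ sym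

bitColour : Bool → Fin 3
bitColour false = zero
bitColour true = suc zero

bitColour≢2 : ∀ i → bitColour i ≢ suc (suc zero)
bitColour≢2 false ()
bitColour≢2 true ()

bitColour-not : ∀ i → bitColour (not i) ≢ bitColour i
bitColour-not false ()
bitColour-not true ()

col3 : Vertex → Fin 3
col3 (x , nd) = bitColour (bit x)
col3 (x , s) = suc (suc zero)
col3 (x , p i) = bitColour (not i)
col3 (x , q i) = suc (suc zero)
col3 (x , r i) = bitColour i

col3-child : ∀ i x → col3 (child i x , nd) ≡ bitColour i
col3-child i x = cong bitColour (bit-child i x)

col3-proper : Proper G 3 col3
col3-proper = edgewise-proper edge
  where
  edge : ∀ {u w} → Edge u w → col3 u ≢ col3 w
  edge (nd-s {x}) = bitColour≢2 (bit x)
  edge s-p = bitColour≢2 _ ∘ sym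
  edge p-q = bitColour≢2 _
  edge q-r = bitColour≢2 _ ∘ sym
  edge (r-p {i = i}) = bitColour-not i ∘ sym
  edge (p-child {x} {i = i} refl) eq = bitColour-not i (trans eq (col3-child i x))
  edge (q-child {x} {i = i} refl) eq = bitColour≢2 i (sym (trans eq (col3-child i x)))
  edge (r-child {x} {i = i} refl) eq = bitColour-not i (sym (trans eq (col3-child (not i) x)))

chromaticNumber : ChromaticNumber≡ G 3
chromaticNumber = (col3 , col3-proper) , λ m m<3 (c , proper) → <⇒≱ m<3 (clique-length≤ proper triangle)
  where
  triangle : AllPairs Adj ((origin , p false) ∷ (origin , q false) ∷ (origin , r false) ∷ [])
  triangle = (inj₁ p-q All.∷ inj₂ r-p All.∷ All.[]) ∷ (inj₁ q-r All.∷ All.[]) ∷ All.[] ∷ []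

slotClass : Slot → Fin 4
slotClass nd = zero
slotClass (p _) = suc zero
slotClass s = suc (suc zero)
slotClass (q _) = suc (suc zero)
slotClass (r _) = suc (suc (suc zero))

col4 : Vertex → Fin 4
col4 (x , σ) = slotClass σ

col4-proper : Proper G 4 col4
col4-proper = edgewise-proper edge
  where
  edge : ∀ {u w} → Edge u w → col4 u ≢ col4 w
  edge nd-s ()
  edge s-p ()
  edge p-q ()
  edge q-r ()
  edge r-p ()
  edge (p-child _) ()
  edge (q-child _) ()
  edge (r-child _) ()

-- Tree symmetries and periodicity

TwistsChildren : (Node → Node) → (Node → Bool) → Set
TwistsChildren τ β = ∀ i x → τ (child i x) ≡ child (i xor β x) (τ x)

xor-cancelʳ : ∀ i b → (i xor b) xor b ≡ i
xor-cancelʳ false false = refl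
xor-cancelʳ false true = refl
xor-cancelʳ true false = refl
xor-cancelʳ true true = refl

flipSlot : Bool → Slot → Slot
flipSlot b nd = nd
flipSlot b s = s
flipSlot b (p i) = p (i xor b)
flipSlot b (q i) = q (i xor b)
flipSlot b (r i) = r (i xor b)

flipSlot-false : ∀ σ → flipSlot false σ ≡ σ
flipSlot-false nd = refl
flipSlot-false s = refl
flipSlot-false (p i) = cong p (xor-identityʳ i)
flipSlot-false (q i) = cong q (xor-identityʳ i)
flipSlot-false (r i) = cong r (xor-identityʳ i)

flipSlot-involutive : ∀ b σ → flipSlot b (flipSlot b σ) ≡ σ
flipSlot-involutive b nd = refl
flipSlot-involutive b s = refl
flipSlot-involutive b (p i) = cong p (xor-cancelʳ i b)
flipSlot-involutive b (q i) = cong q (xor-cancelʳ i b)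
flipSlot-involutive b (r i) = cong r (xor-cancelʳ i b)

slotClass-flipSlot : ∀ b σ → slotClass (flipSlot b σ) ≡ slotClass σ
slotClass-flipSlot b nd = refl
slotClass-flipSlot b s = refl
slotClass-flipSlot b (p i) = refl
slotClass-flipSlot b (q i) = refl
slotClass-flipSlot b (r i) = refl

liftMap : (Node → Node) → (Node → Bool) → Vertex → Vertex
liftMap τ β (x , σ) = τ x , flipSlot (β x) σ

liftMap-adj : ∀ {τ β} → TwistsChildren τ β → ∀ {u w} → Adj u w → Adj (liftMap τ β u) (liftMap τ β w)
liftMap-adj {τ} {β} twists = Sum.map edge edge
  where
  edge : ∀ {u w} → Edge u w → Edge (liftMap τ β u) (liftMap τ β w)
  edge nd-s = nd-s
  edge s-p = s-p
  edge p-q = p-q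
  edge q-r = q-r
  edge r-p = r-p
  edge (p-child {x} {i = i} refl) = p-child (twists i x)
  edge (q-child {x} {i = i} refl) = q-child (twists i x)
  edge (r-child {x} {i = i} refl) =
    r-child (trans (twists (not i) x) (cong (λ j → child j (τ x)) (sym (not-distribˡ-xor i (β x)))))

record TreeSymmetry : Set where
  field
    bijection : Node ↔ Node
    twist     : Node → Bool
    twists    : TwistsChildren (Inverse.to bijection) twist

module _ (T : TreeSymmetry) where
  open TreeSymmetry T
  open Inverse bijection using () renaming (to to τ; from to τ⁻¹; strictlyInverseˡ to ττ⁻¹; strictlyInverseʳ to τ⁻¹τ)

  inverse-twists : TwistsChildren τ⁻¹ (twist ∘ τ⁻¹)
  inverse-twists i y = begin
    τ⁻¹ (child i y)                         ≡⟨ cong (τ⁻¹ ∘ child i) (sym (ττ⁻¹ y)) ⟩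
    τ⁻¹ (child i (τ x))                     ≡⟨ cong (λ j → τ⁻¹ (child j (τ x))) (sym (xor-cancelʳ i b)) ⟩
    τ⁻¹ (child ((i xor b) xor b) (τ x))     ≡⟨ cong τ⁻¹ (sym (twists (i xor b) x)) ⟩
    τ⁻¹ (τ (child (i xor b) x))             ≡⟨ τ⁻¹τ _ ⟩
    child (i xor b) x                       ∎
    where
    open ≡-Reasoning
    x = τ⁻¹ y
    b = twist x

  lift : Automorphism G
  lift = mkAutomorphism
    (mk↔ₛ′ (liftMap τ twist) (liftMap τ⁻¹ (twist ∘ τ⁻¹)) lift-τ⁻¹ lift-τ)
    (liftMap-adj twists) (liftMap-adj inverse-twists)
    where
    lift-τ⁻¹ : ∀ v → liftMap τ twist (liftMap τ⁻¹ (twist ∘ τ⁻¹) v) ≡ v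
    lift-τ⁻¹ (y , σ) = cong₂ _,_ (ττ⁻¹ y) (flipSlot-involutive _ σ)
    lift-τ : ∀ v → liftMap τ⁻¹ (twist ∘ τ⁻¹) (liftMap τ twist v) ≡ v
    lift-τ (x , σ) = cong₂ _,_ (τ⁻¹τ x)
      (trans (cong (λ z → flipSlot (twist z) (flipSlot (twist x) σ)) (τ⁻¹τ x)) (flipSlot-involutive _ σ))

  lift-preserves-col4 : PreservesColouring col4 lift
  lift-preserves-col4 (x , σ) = slotClass-flipSlot (twist x) σ

shift : ℤ → TreeSymmetry
shift n = record
  { bijection = mk↔ₛ′ (λ (k , a) → k ℤ.+ n , a) (λ (k , a) → k ℤ.- n , a)
                      (λ (k , a) → cong (_, a) (//-rightDividesˡ +-0-abelianGroup n k)) (λ (k , a) → cong (_, a) (//-rightDividesʳ +-0-abelianGroup n k))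
  ; twist = λ _ → false
  ; twists = λ i (k , a) → cong₂ _,_ (ℤ.+-assoc ℤ.-1ℤ k n) (cong (push a) (sym (xor-identityʳ i))) }

-- (k , lineThrough m k) runs from the distinguished end through (0 , m) and then along 0-children,
-- so xorWith m moves the spine onto it.
lineThrough : Addr → ℤ → Addr
lineThrough m (+ zero) = m
lineThrough m (+ suc t) = pop (lineThrough m (+ t))
lineThrough m -[1+ zero ] = push m false
lineThrough m -[1+ suc t ] = push (lineThrough m -[1+ t ]) false

lineThrough-coherent : ∀ m k → pop (lineThrough m (ℤ.pred k)) ≡ lineThrough m k
lineThrough-coherent m (+ zero) = pop-push m false
lineThrough-coherent m (+ suc t) = refl
lineThrough-coherent m -[1+ t ] = pop-push (lineThrough m -[1+ t ]) false

xorWith : Addr → TreeSymmetry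
xorWith m = record
  { bijection = mk↔ₛ′ τ τ involutive involutive
  ; twist = λ (k , a) → lastBit (C (ℤ.pred k))
  ; twists = twists }
  where
  C = lineThrough m
  τ : Node → Node
  τ (k , a) = k , a ⊕ C k
  involutive : ∀ x → τ (τ x) ≡ x
  involutive (k , a) = cong (k ,_) (⊕-cancelʳ a (C k))
  twists : TwistsChildren τ (λ (k , a) → lastBit (C (ℤ.pred k)))
  twists i (k , a) = cong (ℤ.pred k ,_) (begin
    push a i ⊕ C (ℤ.pred k)                     ≡⟨ cong (push a i ⊕_) (sym (push-pop (C (ℤ.pred k)))) ⟩
    push a i ⊕ push (pop (C (ℤ.pred k))) b      ≡⟨ push-⊕ a _ i b ⟩
    push (a ⊕ pop (C (ℤ.pred k))) (i xor b)     ≡⟨ cong (λ z → push (a ⊕ z) (i xor b)) (lineThrough-coherent m k) ⟩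
    push (a ⊕ C k) (i xor b)                    ∎)
    where
    open ≡-Reasoning
    b = lastBit (C (ℤ.pred k))

transport : Node → Automorphism G
transport (n , m) = lift (shift n) ∘ᴬ lift (xorWith m)

transport-origin : ∀ x σ → aut G (transport x) (origin , σ) ≡ (x , σ)
transport-origin (n , m) σ = cong₂ (λ k τ → (k , m) , τ) (ℤ.+-identityˡ n)
  (trans (flipSlot-false _) (trans (cong (λ b → flipSlot b σ) (lastBit-push m false)) (flipSlot-false σ)))

transport-preserves-col4 : ∀ x → PreservesColouring col4 (transport x)
transport-preserves-col4 (n , m) =
  ∘ᴬ-preservesColouring {φ = lift (shift n)} {ψ = lift (xorWith m)}
    (lift-preserves-col4 (shift n)) (lift-preserves-col4 (xorWith m))

originSlots : List Vertex
originSlots = map (origin ,_) (nd ∷ s ∷ p false ∷ p true ∷ q false ∷ q true ∷ r false ∷ r true ∷ [])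

∈-originSlots : ∀ σ → (origin , σ) ∈ originSlots
∈-originSlots nd = here refl
∈-originSlots s = there (here refl)
∈-originSlots (p false) = there (there (here refl))
∈-originSlots (p true) = there (there (there (here refl)))
∈-originSlots (q false) = there (there (there (there (here refl))))
∈-originSlots (q true) = there (there (there (there (there (here refl)))))
∈-originSlots (r false) = there (there (there (there (there (there (here refl))))))
∈-originSlots (r true) = there (there (there (there (there (there (there (here refl)))))))

transports⇒finitelyManyOrbits : (H : Automorphism G → Set) → (∀ x → H (transport x)) → FinitelyManyOrbits G H
transports⇒finitelyManyOrbits H H-transport =
  originSlots , λ (x , σ) → (origin , σ) , ∈-originSlots σ , transport x , H-transport x , transport-origin x σ

quasiTransitive : QuasiTransitive G
quasiTransitive = transports⇒finitelyManyOrbits _ (λ _ → tt)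

periodic4 : HasPeriodicProperColouring G 4
periodic4 = col4 , col4-proper , transports⇒finitelyManyOrbits _ transport-preserves-col4

toNode : ∀ v → Walk v (proj₁ v , nd)
toNode (x , nd) = []
toNode (x , s) = inj₂ nd-s ∷ []
toNode (x , p i) = inj₂ s-p ∷ inj₂ nd-s ∷ []
toNode (x , q i) = inj₂ p-q ∷ inj₂ s-p ∷ inj₂ nd-s ∷ []
toNode (x , r i) = inj₁ r-p ∷ inj₂ s-p ∷ inj₂ nd-s ∷ []

toParent : ∀ x → Walk (x , nd) (parent x , nd)
toParent x = inj₂ (p-child (sym (child-parent x))) ∷ inj₂ s-p ∷ inj₂ nd-s ∷ []

toChild : ∀ i x → Walk (x , nd) (child i x , nd)
toChild i x = inj₁ nd-s ∷ inj₁ s-p ∷ inj₁ (p-child refl) ∷ []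

toSpine : ∀ k b → Σ ℤ λ k′ → Walk ((k , pos b) , nd) ((k′ , zero) , nd)
toSpine k one = ℤ.suc k , toParent (k , pos one)
toSpine k (b O) = let k′ , w = toSpine (ℤ.suc k) b in k′ , (toParent (k , pos (b O)) ++ʷ w)
toSpine k (b I) = let k′ , w = toSpine (ℤ.suc k) b in k′ , (toParent (k , pos (b I)) ++ʷ w)

alongSpine : ∀ k → Walk ((k , zero) , nd) (origin , nd)
alongSpine (+ zero) = []
alongSpine (+ suc t) = toChild false (+ suc t , zero) ++ʷ alongSpine (+ t)
alongSpine -[1+ zero ] = toParent (-[1+ zero ] , zero)
alongSpine -[1+ suc t ] = toParent (-[1+ suc t ] , zero) ++ʷ alongSpine -[1+ t ]

toOrigin : ∀ v → Walk v (origin , nd)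
toOrigin v = toNode v ++ʷ fromNode (proj₁ v)
  where
  fromNode : ∀ x → Walk (x , nd) (origin , nd)
  fromNode (k , zero) = alongSpine k
  fromNode (k , pos b) = let k′ , w = toSpine k b in w ++ʷ alongSpine k′

connected : Connected G
connected = rooted⇒connected _≟ⱽ_ (origin , nd) toOrigin

-- Ends

-- The node vertex of a child belongs to its parent's gadget, so stem edges are the only edges
-- between gadgets.
owner : Vertex → Node
owner (x , nd) = parent x
owner (x , s) = x
owner (x , p _) = x
owner (x , q _) = x
owner (x , r _) = x

owner-edge : ∀ {u w} → Edge u w → owner u ≡ owner w ⊎ ∃ λ x → u ≡ (x , nd) × w ≡ (x , s)
owner-edge (nd-s {x}) = inj₂ (x , refl , refl)
owner-edge s-p = inj₁ refl
owner-edge p-q = inj₁ refl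
owner-edge q-r = inj₁ refl
owner-edge r-p = inj₁ refl
owner-edge (p-child {x} {i = i} refl) = inj₁ (sym (parent-child i x))
owner-edge (q-child {x} {i = i} refl) = inj₁ (sym (parent-child i x))
owner-edge (r-child {x} {i = i} refl) = inj₁ (sym (parent-child (not i) x))

level0Ancestor : Node → Maybe Addr
level0Ancestor (+ zero , a) = just a
level0Ancestor (+ suc _ , _) = nothing
level0Ancestor (-[1+ t ] , a) = just (iterate pop a (suc t))

level0Ancestor-child : ∀ {A} i x → level0Ancestor x ≡ just A → level0Ancestor (child i x) ≡ just A
level0Ancestor-child i (+ zero , a) eq = trans (cong just (pop-push a i)) eq
level0Ancestor-child i (-[1+ t ] , a) eq = trans (cong (λ b → just (iterate pop b (suc t))) (pop-push a i)) eq

level0Ancestor-parent : ∀ {A} x → level0Ancestor (parent x) ≡ just A → level0Ancestor x ≡ just A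
level0Ancestor-parent {A} x eq =
  subst (λ y → level0Ancestor y ≡ just A) (child-parent x) (level0Ancestor-child (bit x) (parent x) eq)

level0Ancestor-leave : ∀ {A} x → level0Ancestor x ≡ just A → level0Ancestor (parent x) ≢ just A → x ≡ (+0 , A)
level0Ancestor-leave (+ zero , a) eq _ = cong (+0 ,_) (just-injective eq)
level0Ancestor-leave (-[1+ zero ] , a) eq stays-outside = ⊥-elim (stays-outside eq)
level0Ancestor-leave (-[1+ suc t ] , a) eq stays-outside = ⊥-elim (stays-outside eq)

Below : Addr → Vertex → Set
Below A v = level0Ancestor (owner v) ≡ just A

below? : ∀ A v → Dec (Below A v)
below? A v = Maybe.≡-dec _≟ᵃ_ (level0Ancestor (owner v)) (just A)

below-exit : ∀ {A u w} → Adj u w → Below A u → ¬ Below A w → u ≡ ((+0 , A) , s)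
below-exit {A} (inj₁ e) inside outside with owner-edge e
... | inj₁ same = ⊥-elim (outside (subst (λ y → level0Ancestor y ≡ just A) same inside))
... | inj₂ (x , refl , refl) = ⊥-elim (outside (level0Ancestor-parent x inside))
below-exit {A} (inj₂ e) inside outside with owner-edge e
... | inj₁ same = ⊥-elim (outside (subst (λ y → level0Ancestor y ≡ just A) (sym same) inside))
... | inj₂ (x , refl , refl) = cong (_, s) (level0Ancestor-leave x inside outside)

below-unique : ∀ {A B} v → Below A v → Below B v → A ≡ B
below-unique v inA inB = just-injective (trans (sym inA) inB)

descendingRay : Node → ℕ → Vertex
descendingRay x 0 = x , s
descendingRay x 1 = x , p false
descendingRay x 2 = child false x , nd
descendingRay x (suc (suc (suc n))) = descendingRay (child false x) n

descendingRay-adj : ∀ x n → Adj (descendingRay x n) (descendingRay x (suc n))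
descendingRay-adj x 0 = inj₁ s-p
descendingRay-adj x 1 = inj₁ (p-child refl)
descendingRay-adj x 2 = inj₁ nd-s
descendingRay-adj x (suc (suc (suc n))) = descendingRay-adj (child false x) n

descendingRay-below : ∀ {A} x → level0Ancestor x ≡ just A → ∀ n → Below A (descendingRay x n)
descendingRay-below x inside 0 = inside
descendingRay-below x inside 1 = inside
descendingRay-below {A} x inside 2 = subst (λ y → level0Ancestor y ≡ just A) (sym (parent-child false x)) inside
descendingRay-below x inside (suc (suc (suc n))) =
  descendingRay-below (child false x) (level0Ancestor-child false x inside) n

-- The position on a descending ray from level 0; the values on q and r slots are junk.
rayIndex : Vertex → ℕ
rayIndex ((k , _) , s) = ℤ.∣ k ∣ ℕ.* 3
rayIndex ((k , _) , p _) = suc (ℤ.∣ k ∣ ℕ.* 3)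
rayIndex ((k , _) , nd) = ℤ.∣ k ∣ ℕ.* 3 ℕ.∸ 1
rayIndex (_ , q _) = 0
rayIndex (_ , r _) = 0

pred-neg : ∀ t → ℤ.pred (- (+ t)) ≡ - (+ suc t)
pred-neg zero = refl
pred-neg (suc t) = refl

rayIndex-descendingRay : ∀ t x → proj₁ x ≡ - (+ t) → ∀ n → rayIndex (descendingRay x n) ≡ n + t ℕ.* 3
rayIndex-descendingRay t (k , a) refl 0 = cong (ℕ._* 3) (ℤ.∣-i∣≡∣i∣ (+ t))
rayIndex-descendingRay t (k , a) refl 1 = cong (λ z → suc (z ℕ.* 3)) (ℤ.∣-i∣≡∣i∣ (+ t))
rayIndex-descendingRay t (k , a) refl 2 = cong (λ z → ℤ.∣ z ∣ ℕ.* 3 ℕ.∸ 1) (pred-neg t)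
rayIndex-descendingRay t (k , a) refl (suc (suc (suc n))) = begin
  rayIndex (descendingRay (child false (k , a)) n)  ≡⟨ rayIndex-descendingRay (suc t) (child false (k , a)) (pred-neg t) n ⟩
  n + (3 + t ℕ.* 3)                                ≡⟨ sym (ℕ.+-assoc n 3 _) ⟩
  (n + 3) + t ℕ.* 3                                ≡⟨ cong (ℕ._+ t ℕ.* 3) (ℕ.+-comm n 3) ⟩
  3 + n + t ℕ.* 3                                  ∎
  where open ≡-Reasoning

rayBelow : Addr → Ray G
rayBelow A = record
  { seq = descendingRay (+0 , A)
  ; adj = descendingRay-adj (+0 , A)
  ; inj = λ {m} {n} eq → trans (sym (index m)) (trans (cong rayIndex eq) (index n)) }
  where
  index : ∀ n → rayIndex (descendingRay (+0 , A) n) ≡ n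
  index n = trans (rayIndex-descendingRay 0 (+0 , A) refl n) (ℕ.+-identityʳ n)

allOnes : ℕ → Addr
allOnes = fold zero (λ a → push a true)

push-true≢zero : ∀ a → push a true ≢ zero
push-true≢zero zero ()
push-true≢zero (pos _) ()

allOnes-injective : Injective _≡_ _≡_ allOnes
allOnes-injective {zero} {zero} _ = refl
allOnes-injective {zero} {suc n} eq = ⊥-elim (push-true≢zero (allOnes n) (sym eq))
allOnes-injective {suc m} {zero} eq = ⊥-elim (push-true≢zero (allOnes m) eq)
allOnes-injective {suc m} {suc n} eq =
  cong suc (allOnes-injective (trans (sym (pop-push _ true)) (trans (cong pop eq) (pop-push _ true))))

infinitelyManyEnds : InfinitelyManyEnds G
infinitelyManyEnds n = ray ∘ toℕ , λ i j i≢j →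
  separated-rays-inequivalent (below? (allOnes (toℕ i))) below-exit (ray (toℕ i)) (ray (toℕ j))
    (inside (toℕ i)) (λ m inI → i≢j (toℕ-injective (allOnes-injective (below-unique (Ray.seq (ray (toℕ j)) m) inI (inside (toℕ j) m)))))
  where
  ray : ℕ → Ray G
  ray a = rayBelow (allOnes a)
  inside : ∀ a m → Below (allOnes a) (Ray.seq (ray a) m)
  inside a = descendingRay-below (+0 , allOnes a) refl

-- Recognising the tree

nd≁p : ∀ {x i} → ¬ Adj (x , nd) (x , p i)
nd≁p (inj₁ ())
nd≁p {x} {i} (inj₂ (p-child eq)) = child≢ i x (sym eq)

stem-triangleFree : ∀ x → ¬ InTriangle (x , s)
stem-triangleFree x (_ , _ , inj₂ nd-s , inj₂ nd-s , ab) = Adj-irrefl ab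
stem-triangleFree x (_ , _ , inj₂ nd-s , inj₁ s-p , ab) = nd≁p ab
stem-triangleFree x (_ , _ , inj₁ s-p , inj₂ nd-s , ab) = nd≁p (Adj-sym ab)
stem-triangleFree x (_ , _ , inj₁ s-p , inj₁ s-p , inj₁ ())
stem-triangleFree x (_ , _ , inj₁ s-p , inj₁ s-p , inj₂ ())

triangleFree⇒stem : ∀ v → ¬ InTriangle v → proj₂ v ≡ s
triangleFree⇒stem (x , nd) free =
  ⊥-elim (free ((parent x , p (bit x)) , (parent x , q (bit x)) ,
                inj₂ (p-child (sym (child-parent x))) , inj₂ (q-child (sym (child-parent x))) , inj₁ p-q))
triangleFree⇒stem (x , s) free = refl
triangleFree⇒stem (x , p i) free = ⊥-elim (free (_ , _ , inj₁ p-q , inj₂ r-p , inj₁ q-r))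
triangleFree⇒stem (x , q i) free = ⊥-elim (free (_ , _ , inj₂ p-q , inj₁ q-r , inj₂ r-p))
triangleFree⇒stem (x , r i) free = ⊥-elim (free (_ , _ , inj₁ r-p , inj₂ q-r , inj₁ p-q))

p-onTwoTriangles : ∀ x i → OnTwoTriangles (x , p i)
p-onTwoTriangles x i = _ , _ , _ , inj₁ p-q , inj₂ r-p , inj₁ (p-child refl) , inj₁ q-r , inj₁ (q-child refl) , λ ()

children-differ : ∀ {x y i} → x ≡ child i y → x ≢ child (not i) y
children-differ {x} {y} {i} eq eq′ = not-¬ refl (proj₁ (child-injective {i} {not i} {y} {y} (trans (sym eq) eq′)))

common-p : ∀ {x y i b} → x ≡ child i y → Adj (x , nd) b → Adj (y , p i) b → b ≡ (y , q i)
common-p eq (inj₁ nd-s) (inj₂ s-p) = ⊥-elim (child≢ _ _ (sym eq))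
common-p eq _ (inj₁ p-q) = refl
common-p {x} {y} {i} eq (inj₂ (r-child eq′)) (inj₂ r-p) = ⊥-elim (children-differ {x} {y} {i} eq eq′)
common-p eq (inj₂ ()) (inj₁ (p-child refl))

common-q : ∀ {x y i b} → x ≡ child i y → Adj (x , nd) b → Adj (y , q i) b → b ≡ (y , p i)
common-q eq _ (inj₂ p-q) = refl
common-q eq (inj₁ ()) (inj₁ q-r)
common-q {x} {y} {i} eq (inj₂ (r-child eq′)) (inj₁ q-r) = ⊥-elim (children-differ {x} {y} {i} eq eq′)
common-q eq (inj₁ ()) (inj₁ (q-child refl))

common-r : ∀ {x y i b} → x ≡ child (not i) y → Adj (x , nd) b → ¬ Adj (y , r i) b
common-r eq (inj₁ ()) (inj₂ q-r)
common-r {x} {y} {i} eq (inj₂ (q-child eq′)) (inj₂ q-r) = children-differ {x} {y} {i} eq′ eq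
common-r eq (inj₁ ()) (inj₁ r-p)
common-r {x} {y} {i} eq (inj₂ (p-child eq′)) (inj₁ r-p) = children-differ {x} {y} {i} eq′ eq
common-r eq (inj₁ ()) (inj₁ (r-child refl))

nd-notOnTwoTriangles : ∀ x → ¬ OnTwoTriangles (x , nd)
nd-notOnTwoTriangles x (_ , _ , _ , inj₁ nd-s , vb , _ , inj₂ nd-s , _) = Adj-irrefl vb
nd-notOnTwoTriangles x (_ , _ , _ , inj₁ nd-s , vb , _ , inj₁ s-p , _) = nd≁p vb
nd-notOnTwoTriangles x (_ , _ , _ , inj₂ (p-child eq) , vb , vd , ab , ad , b≢d) =
  b≢d (trans (common-p eq vb ab) (sym (common-p eq vd ad)))
nd-notOnTwoTriangles x (_ , _ , _ , inj₂ (q-child eq) , vb , vd , ab , ad , b≢d) =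
  b≢d (trans (common-q eq vb ab) (sym (common-q eq vd ad)))
nd-notOnTwoTriangles x (_ , _ , _ , inj₂ (r-child eq) , vb , _ , ab , _) = common-r eq vb ab

-- Stems are the only triangle-free vertices, and of their neighbours only the p i have an edge on
-- two triangles; so the following notions pick out node vertices and children, and being stated
-- by adjacency alone they are preserved by every automorphism.
NodeLike : Vertex → Set
NodeLike v = (∃ λ a → Adj v a × ¬ InTriangle a) × ¬ OnTwoTriangles v

ChildLike : Vertex → Vertex → Set
ChildLike v w = NodeLike v × NodeLike w × ∃₂ λ a b → Adj v a × ¬ InTriangle a × Adj a b × Adj b w

nodeLike-nd : ∀ x → NodeLike (x , nd)
nodeLike-nd x = ((x , s) , inj₁ nd-s , stem-triangleFree x) , nd-notOnTwoTriangles x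

stem-neighbour : ∀ {v y} → Adj v (y , s) → v ≡ (y , nd) ⊎ ∃ λ i → v ≡ (y , p i)
stem-neighbour (inj₁ nd-s) = inj₁ refl
stem-neighbour (inj₂ (s-p {i = i})) = inj₂ (i , refl)

nodeLike⇒nd : ∀ v → NodeLike v → v ≡ (proj₁ v , nd)
nodeLike⇒nd v (((y , σ) , va , free) , single) with triangleFree⇒stem (y , σ) free
... | refl with stem-neighbour va
...   | inj₁ refl = refl
...   | inj₂ (i , refl) = ⊥-elim (single (p-onTwoTriangles y i))

childLike-child : ∀ i x → ChildLike (x , nd) (child i x , nd)
childLike-child i x =
  nodeLike-nd x , nodeLike-nd (child i x) ,
  (x , s) , (x , p i) , inj₁ nd-s , stem-triangleFree x , inj₁ s-p , inj₁ (p-child refl)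

childLike⇒child : ∀ {x w} → ChildLike (x , nd) w → ∃ λ i → w ≡ (child i x , nd)
childLike⇒child {x} {w} (_ , w-node , (y , σ) , b , va , free , ab , bw)
  with nodeLike⇒nd w w-node | triangleFree⇒stem (y , σ) free
... | refl | refl with va
...   | inj₂ ()
...   | inj₁ nd-s with stem-neighbour (Adj-sym ab) | bw
...     | inj₁ refl | inj₁ ()
...     | inj₁ refl | inj₂ ()
...     | inj₂ (i , refl) | inj₁ (p-child refl) = i , refl
...     | inj₂ (i , refl) | inj₂ ()

module _ (φ : Automorphism G) where
  private
    f = aut G φ
    f~ = Automorphism.pres φ
    triangleFree-aut : ∀ {a} → ¬ InTriangle a → ¬ InTriangle (f a)
    triangleFree-aut free = free ∘ reflects-aut InTriangle inTriangle-aut φ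

  nodeLike-aut : ∀ {v} → NodeLike v → NodeLike (f v)
  nodeLike-aut ((a , va , free) , single) =
    (f a , f~ va , triangleFree-aut free) , single ∘ reflects-aut OnTwoTriangles onTwoTriangles-aut φ

  childLike-aut : ∀ {v w} → ChildLike v w → ChildLike (f v) (f w)
  childLike-aut (v-node , w-node , a , b , va , free , ab , bw) =
    nodeLike-aut v-node , nodeLike-aut w-node , f a , f b , f~ va , triangleFree-aut free , f~ ab , f~ bw

  nodeMap : Node → Node
  nodeMap x = proj₁ (f (x , nd))

  aut-nd : ∀ x → f (x , nd) ≡ (nodeMap x , nd)
  aut-nd x = nodeLike⇒nd (f (x , nd)) (nodeLike-aut (nodeLike-nd x))

  nodeMap-child : ∀ i x → ∃ λ j → nodeMap (child i x) ≡ child j (nodeMap x)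
  nodeMap-child i x =
    let j , eq = childLike⇒child (subst₂ ChildLike (aut-nd x) (aut-nd (child i x))
                                   (childLike-aut (childLike-child i x)))
    in j , cong proj₁ eq

  nodeMap-injective : Injective _≡_ _≡_ nodeMap
  nodeMap-injective {x} {y} eq =
    cong proj₁ (aut-injective φ (trans (aut-nd x) (trans (cong (_, nd) eq) (sym (aut-nd y)))))

  nodeMap-twists : Σ (Node → Bool) (TwistsChildren nodeMap)
  nodeMap-twists = (λ x → proj₁ (nodeMap-child false x)) , twists
    where
    twists : TwistsChildren nodeMap (λ x → proj₁ (nodeMap-child false x))
    twists false x = proj₂ (nodeMap-child false x)
    twists true x = trans eq₁ (cong (λ j → child j (nodeMap x)) (¬-not j₁≢j₀))
      where
      j₀ = proj₁ (nodeMap-child false x)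
      j₁ = proj₁ (nodeMap-child true x)
      eq₀ = proj₂ (nodeMap-child false x)
      eq₁ = proj₂ (nodeMap-child true x)
      j₁≢j₀ : j₁ ≢ j₀
      j₁≢j₀ same with child-injective {false} {true} {x} {x}
        (nodeMap-injective (trans eq₀ (trans (cong (λ j → child j (nodeMap x)) (sym same)) (sym eq₁))))
      ... | () , _

nodeMap-inverseˡ : ∀ φ x → nodeMap (φ ⁻¹ᴬ) (nodeMap φ x) ≡ x
nodeMap-inverseˡ φ x = cong proj₁ (trans (cong (aut G (φ ⁻¹ᴬ)) (sym (aut-nd φ x))) (aut-inverseˡ φ (x , nd)))

-- No periodic proper 3-colouring

module Descent {c : Vertex → Fin 3} (proper : Proper G 3 c) where

  childColour : Node → Bool → Fin 3
  childColour x i = c (child i x , nd)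

  -- child false x sees p false and q false, child true x sees r false: equal colours on the two
  -- children would make four pairwise different colours.
  children-coloured-apart : ∀ x → childColour x true ≢ childColour x false
  children-coloured-apart x same = 1+n≰n (unique-length≤ distinct)
    where
    distinct : Unique (c (x , p false) ∷ c (x , q false) ∷ c (x , r false) ∷ childColour x false ∷ [])
    distinct = (proper (inj₁ p-q) All.∷ proper (inj₂ r-p) All.∷ proper (inj₁ (p-child refl)) All.∷ All.[])
             ∷ (proper (inj₁ q-r) All.∷ proper (inj₁ (q-child refl)) All.∷ All.[])
             ∷ ((λ eq → proper (inj₁ (r-child refl)) (trans eq (sym same))) All.∷ All.[])
             ∷ All.[] ∷ []

  descent : Node → Node
  descent x = child (smallerOf (childColour x)) x

  descent-injective : Injective _≡_ _≡_ descent
  descent-injective {x} {y} eq = proj₂ (child-injective {x = x} {y = y} eq)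

  skippedChild : Node
  skippedChild = child (not (smallerOf (childColour origin))) origin

  skippedChild∉descent : ∀ x → descent x ≢ skippedChild
  skippedChild∉descent x eq =
    let same-bit , x≡origin = child-injective {x = x} {y = origin} eq
    in not-¬ refl (subst (λ y → smallerOf (childColour y) ≡ not (smallerOf (childColour origin)))
                         x≡origin same-bit)

  descent-aut : ∀ φ → PreservesColouring c φ → ∀ x → nodeMap φ (descent x) ≡ descent (nodeMap φ x)
  descent-aut φ preserves x = trans (twists (smallerOf (childColour x)) x) (cong (λ j → child j (nodeMap φ x))
    (sym (smallerOf-twist {g′ = childColour (nodeMap φ x)} (β x) (children-coloured-apart x) same)))
    where
    β = proj₁ (nodeMap-twists φ)
    twists = proj₂ (nodeMap-twists φ)
    same : ∀ i → childColour (nodeMap φ x) (i xor β x) ≡ childColour x i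
    same i = begin
      c (child (i xor β x) (nodeMap φ x) , nd)  ≡⟨ cong (λ y → c (y , nd)) (sym (twists i x)) ⟩
      c (nodeMap φ (child i x) , nd)            ≡⟨ cong c (sym (aut-nd φ (child i x))) ⟩
      c (aut G φ (child i x , nd))              ≡⟨ preserves _ ⟩
      c (child i x , nd)                        ∎
      where open ≡-Reasoning

  not-periodic : ¬ Periodic G 3 c
  not-periodic periodic with periodic-sequence-recurs {c = c} periodic (λ n → fold skippedChild descent n , nd)
  ... | m , n , m<n , φ , preserves , moves =
    commuting-map-cannot-advance {g = nodeMap φ} {h = nodeMap (φ ⁻¹ᴬ)}
      descent-injective skippedChild∉descent (nodeMap-inverseˡ φ) (descent-aut φ preserves) (descent-aut (φ ⁻¹ᴬ) (⁻¹ᴬ-preservesColouring {φ = φ} preserves))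
      m<n (cong proj₁ (trans (sym (aut-nd φ _)) moves))

noPeriodic3 : ¬ HasPeriodicProperColouring G 3
noPeriodic3 (c , proper , periodic) = Descent.not-periodic proper periodic

mainTheorem12 : Σ Graph λ G →
    Connected G × LocallyFinite G × QuasiTransitive G × InfinitelyManyEnds G
    × ChromaticNumber≡ G 3 × MaxDegree≡ G 4
    × HasPeriodicProperColouring G 4 × ¬ HasPeriodicProperColouring G 3
mainTheorem12 =
  G , connected , locallyFinite , quasiTransitive , infinitelyManyEnds , chromaticNumber , maxDegree ,
  periodic4 , noPeriodic3
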